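{- Let $A=(1,a_1,\ldots,a_k)$ be an orderly currency with $a_1\geq 3$. Then $a_i-a_{i-1}\neq 1$ for all $i=1,\ldots,k$.
   Context: A currency is a finite sequence of integers $A=(a_0,a_1,\ldots,a_k)$ with $1=a_0<a_1<\cdots<a_k$. For an integer amount $c>0$, $\mathrm{opt}_A(c)$ is the minimum number of coins (values from $A$, repetitions allowed) summing to $c$, and $\mathrm{grd}_A(c)$ is the number of coins used by the greedy algorithm, which repeatedly takes the largest coin not exceeding the remaining amount. $A$ is orderly if $\mathrm{opt}_A(c)=\mathrm{grd}_A(c)$ for all integers $c>0$. -}

module Defs where

open import Data.Nat using (ℕ; zero; suc; _+_; _*_; _∸_; _≤_; _<_; _≤ᵇ_)
open import Data.Bool using (if_then_else_)
open import Data.Fin using (Fin; inject₁) renaming (suc to fsuc; zero to fzero)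
open import Data.Vec using (Vec; lookup; toList; sum; zipWith)
open import Data.List using (List; []; _∷_)
open import Data.Product using (Σ; _×_)
open import Relation.Binary.PropositionalEquality using (_≡_)

record Currency {n : ℕ} (A : Vec ℕ (suc n)) : Set where
  field
    first-one  : lookup A fzero ≡ 1
    increasing : (i : Fin n) → lookup A (inject₁ i) < lookup A (fsuc i)

value : {n : ℕ} → Vec ℕ n → Vec ℕ n → ℕ
value A r = sum (zipWith _*_ r A)

size : {n : ℕ} → Vec ℕ n → ℕ
size r = sum r

IsOpt : {n : ℕ} → Vec ℕ n → ℕ → ℕ → Set
IsOpt {n} A c m =
  Σ (Vec ℕ n) (λ r → value A r ≡ c × size r ≡ m)
  × ((r : Vec ℕ n) → value A r ≡ c → m ≤ size r)

-- largest coin in the list not exceeding c (0 if there is none)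
largestCoin : List ℕ → ℕ → ℕ
largestCoin [] c = 0
largestCoin (a ∷ as) c =
  let b = largestCoin as c in
  if a ≤ᵇ c then (if b ≤ᵇ a then a else b) else b

-- The fuel argument bounds the number of
-- steps; fuel c suffices for amount c since a_0 = 1, so every step removes
-- at least 1.
greedyAux : List ℕ → ℕ → ℕ → ℕ
greedyAux as zero c = 0
greedyAux as (suc f) zero = 0
greedyAux as (suc f) (suc c) = suc (greedyAux as f (suc c ∸ largestCoin as (suc c)))

grd : {n : ℕ} → Vec ℕ n → ℕ → ℕ
grd A c = greedyAux (toList A) c c

Orderly : {n : ℕ} → Vec ℕ n → Set
Orderly A = (c : ℕ) → 0 < c → IsOpt A c (grd A c)

-- Write L(c) for the largest coin ≤ c.  Orderliness gives grd(x + y) ≤ 2 for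
-- any two coins x, y (the two-coin representation has size 2), and since the
-- greedy algorithm starts with L(x + y), the remainder x + y − L(x + y) is
-- zero or a single coin.  Suppose m, m + 1 are coins, m minimal.  Then m ≥ 3,
-- and we climb through coins g < h < g + m: as long as L(h + m − 1) > h, the
-- pair (h, L(h + m − 1)) is again of this kind, and h grows, so this stops
-- (coins are bounded).  Once L(h + m − 1) = h, the coin h is the largest
-- coin below every amount in [h, h + m − 1]; the amounts m + g and m + 1 + g
-- lie there, so r = m + g − h and r + 1 are both coins (for g + 1 = h,
-- r + 1 = m).  As 0 < r < m, this contradicts minimality of m.
module Submission where

open import Defs
open import Data.Nat using (ℕ; zero; suc; _+_; _*_; _≤_; _<_; _∸_; _≤ᵇ_; z≤n; s≤s; _<?_)
open import Data.Nat.Properties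
open import Data.Nat.Induction using (<-rec)
open import Algebra.Properties.CommutativeSemigroup +-commutativeSemigroup using (x∙yz≈y∙xz)
open import Data.Bool using (true; false; T)
open import Data.Empty using (⊥; ⊥-elim)
open import Data.Sum using (_⊎_; inj₁; inj₂)
open import Data.Product using (Σ-syntax; _×_; _,_; proj₂)
open import Data.Fin using (Fin; inject₁) renaming (suc to fsuc; zero to fzero)
open import Data.Vec using (Vec; lookup; toList; replicate; updateAt; []; _∷_)
open import Data.Vec.Membership.Propositional.Properties using (∈-lookup; ∈-toList⁺; ∈-toList⁻)
open import Data.Vec.Relation.Unary.Any using (index)
open import Data.Vec.Relation.Unary.Any.Properties using (lookup-index)
open import Data.List using (List) renaming ([] to nil; _∷_ to cons)
open import Data.Nat.ListAction using (sum)
open import Data.List.Membership.Propositional using (_∈_)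
open import Data.List.Relation.Unary.Any using (here; there)
import Data.Sum as Sum
open import Relation.Nullary using (yes; no; ¬_)
open import Relation.Binary.PropositionalEquality
  using (_≡_; _≢_; refl; sym; trans; cong; subst; module ≡-Reasoning)

private
  T-true : ∀ {b} → b ≡ true → T b
  T-true refl = _

  T-false : ∀ {b} → b ≡ false → ¬ T b
  T-false refl ()

largestCoin-≤ : ∀ xs c → largestCoin xs c ≤ c
largestCoin-≤ nil c = z≤n
largestCoin-≤ (cons a as) c with a ≤ᵇ c in a≤c
... | false = largestCoin-≤ as c
... | true with largestCoin as c ≤ᵇ a
...   | true = ≤ᵇ⇒≤ a c (T-true a≤c)
...   | false = largestCoin-≤ as c

largestCoin-0⊎∈ : ∀ xs c → largestCoin xs c ≡ 0 ⊎ largestCoin xs c ∈ xs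
largestCoin-0⊎∈ nil c = inj₁ refl
largestCoin-0⊎∈ (cons a as) c with a ≤ᵇ c
... | false = Sum.map₂ there (largestCoin-0⊎∈ as c)
... | true with largestCoin as c ≤ᵇ a
...   | true = inj₂ (here refl)
...   | false = Sum.map₂ there (largestCoin-0⊎∈ as c)

largestCoin-∈ : ∀ xs c → 0 < largestCoin xs c → largestCoin xs c ∈ xs
largestCoin-∈ xs c pos with largestCoin-0⊎∈ xs c
... | inj₁ zero≡ = ⊥-elim (<-irrefl (sym zero≡) pos)
... | inj₂ mem = mem

largestCoin-max : ∀ xs c {y} → y ∈ xs → y ≤ c → y ≤ largestCoin xs c
largestCoin-max (cons a as) c y∈ y≤c with a ≤ᵇ c in a≤c
largestCoin-max (cons a as) c (here refl) y≤c | false = ⊥-elim (T-false a≤c (≤⇒≤ᵇ y≤c))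
largestCoin-max (cons a as) c (there y∈) y≤c | false = largestCoin-max as c y∈ y≤c
... | true with largestCoin as c ≤ᵇ a in b≤ᵇa
largestCoin-max (cons a as) c (here refl) y≤c | true | true = ≤-refl
largestCoin-max (cons a as) c (there y∈) y≤c | true | true =
  ≤-trans (largestCoin-max as c y∈ y≤c) (≤ᵇ⇒≤ _ a (T-true b≤ᵇa))
largestCoin-max (cons a as) c (here refl) y≤c | true | false =
  <⇒≤ (≰⇒> (λ b≤a → T-false b≤ᵇa (≤⇒≤ᵇ b≤a)))
largestCoin-max (cons a as) c (there y∈) y≤c | true | false = largestCoin-max as c y∈ y≤c

largestCoin-plateau : ∀ xs {h x y} → h ∈ xs → h ≤ x → x ≤ y →
                      largestCoin xs y ≤ h → largestCoin xs x ≡ h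
largestCoin-plateau xs {h} {x} {y} h∈ h≤x x≤y Ly≤h =
  ≤-antisym Lx≤h (largestCoin-max xs x h∈ h≤x)
  where
    Lx≤h : largestCoin xs x ≤ h
    Lx≤h with largestCoin-0⊎∈ xs x
    ... | inj₁ Lx≡0 = ≤-trans (≤-reflexive Lx≡0) z≤n
    ... | inj₂ Lx∈ = ≤-trans (largestCoin-max xs y Lx∈ (≤-trans (largestCoin-≤ xs x) x≤y)) Ly≤h

-- The greedy count, for a coin list containing 1 (so every step makes
-- progress).
module Greedy (xs : List ℕ) (1∈xs : 1 ∈ xs) where

  greedy : ℕ → ℕ
  greedy c = greedyAux xs c c

  largestCoin-pos : ∀ {c} → 1 ≤ c → 1 ≤ largestCoin xs c
  largestCoin-pos 1≤c = largestCoin-max xs _ 1∈xs 1≤c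

  step-decreases : ∀ c → suc c ∸ largestCoin xs (suc c) ≤ c
  step-decreases c = ∸-monoʳ-≤ (suc c) (largestCoin-pos (s≤s z≤n))

  greedyAux-fuel : ∀ f₁ f₂ c → c ≤ f₁ → c ≤ f₂ → greedyAux xs f₁ c ≡ greedyAux xs f₂ c
  greedyAux-fuel zero zero zero _ _ = refl
  greedyAux-fuel zero (suc f₂) zero _ _ = refl
  greedyAux-fuel (suc f₁) zero zero _ _ = refl
  greedyAux-fuel (suc f₁) (suc f₂) zero _ _ = refl
  greedyAux-fuel (suc f₁) (suc f₂) (suc c) (s≤s c≤f₁) (s≤s c≤f₂) =
    cong suc (greedyAux-fuel f₁ f₂ _ (≤-trans (step-decreases c) c≤f₁)
                                     (≤-trans (step-decreases c) c≤f₂))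

  greedy-step : ∀ c → 1 ≤ c → greedy c ≡ suc (greedy (c ∸ largestCoin xs c))
  greedy-step (suc c) _ = cong suc (greedyAux-fuel c _ _ (step-decreases c) ≤-refl)

  greedy-≤1⇒∈ : ∀ z → 1 ≤ z → greedy z ≤ 1 → z ∈ xs
  greedy-≤1⇒∈ z 1≤z greedy≤1 = subst (_∈ xs) Lz≡z (largestCoin-∈ xs z (largestCoin-pos 1≤z))
    where
      rest≡0 : greedy (z ∸ largestCoin xs z) ≡ 0
      rest≡0 = n≤0⇒n≡0 (≤-pred (subst (_≤ 1) (greedy-step z 1≤z) greedy≤1))
      amount≡0 : ∀ c → greedy c ≡ 0 → c ≡ 0
      amount≡0 zero _ = refl
      Lz≡z : largestCoin xs z ≡ z
      Lz≡z = ≤-antisym (largestCoin-≤ xs z) (m∸n≡0⇒m≤n (amount≡0 _ rest≡0))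

addCoin : ∀ {n} → Fin n → Vec ℕ n → Vec ℕ n
addCoin i r = updateAt r i suc

value-empty : ∀ {n} (A : Vec ℕ n) → value A (replicate n 0) ≡ 0
value-empty [] = refl
value-empty (a ∷ A) = value-empty A

size-empty : ∀ n → size (replicate n 0) ≡ 0
size-empty zero = refl
size-empty (suc n) = size-empty n

value-addCoin : ∀ {n} (A r : Vec ℕ n) i → value A (addCoin i r) ≡ lookup A i + value A r
value-addCoin (a ∷ A) (r ∷ rs) fzero = +-assoc a (r * a) (value A rs)
value-addCoin (a ∷ A) (r ∷ rs) (fsuc i) = begin
  r * a + value A (addCoin i rs)      ≡⟨ cong (r * a +_) (value-addCoin A rs i) ⟩
  r * a + (lookup A i + value A rs)   ≡⟨ x∙yz≈y∙xz (r * a) (lookup A i) (value A rs) ⟩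
  lookup A i + (r * a + value A rs)   ∎
  where open ≡-Reasoning

size-addCoin : ∀ {n} (r : Vec ℕ n) i → size (addCoin i r) ≡ suc (size r)
size-addCoin (r ∷ rs) fzero = refl
size-addCoin (r ∷ rs) (fsuc i) = trans (cong (r +_) (size-addCoin rs i)) (+-suc r (size rs))

orderly-two-coins : ∀ {n} (A : Vec ℕ n) → Orderly A → ∀ i j →
                    0 < lookup A i + lookup A j → grd A (lookup A i + lookup A j) ≤ 2
orderly-two-coins {n} A orderly i j pos =
  subst (grd A (lookup A i + lookup A j) ≤_) size≡2 (proj₂ (orderly _ pos) pair value≡)
  where
    none one pair : Vec ℕ n
    none = replicate n 0
    one = addCoin j none
    pair = addCoin i one
    value≡ : value A pair ≡ lookup A i + lookup A j
    value≡ = begin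
      value A pair                              ≡⟨ value-addCoin A one i ⟩
      lookup A i + value A one                  ≡⟨ cong (lookup A i +_) (value-addCoin A none j) ⟩
      lookup A i + (lookup A j + value A none)  ≡⟨ cong (λ v → lookup A i + (lookup A j + v)) (value-empty A) ⟩
      lookup A i + (lookup A j + 0)             ≡⟨ cong (lookup A i +_) (+-identityʳ (lookup A j)) ⟩
      lookup A i + lookup A j                   ∎
      where open ≡-Reasoning
    size≡2 : size pair ≡ 2
    size≡2 = trans (size-addCoin one i) (cong suc (trans (size-addCoin none j) (cong suc (size-empty n))))

currency-≥a₁ : ∀ {k} (A : Vec ℕ (suc (suc k))) → Currency A →
               ∀ i → lookup A (fsuc fzero) ≤ lookup A (fsuc i)
currency-≥a₁ (a₀ ∷ as) cur = increasing-head-≤ as (λ i → Currency.increasing cur (fsuc i))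
  where
    increasing-head-≤ : ∀ {n} (v : Vec ℕ (suc n)) →
                        (∀ i → lookup v (inject₁ i) < lookup v (fsuc i)) →
                        ∀ i → lookup v fzero ≤ lookup v i
    increasing-head-≤ v inc fzero = ≤-refl
    increasing-head-≤ (x ∷ y ∷ v) inc (fsuc i) =
      ≤-trans (<⇒≤ (inc fzero)) (increasing-head-≤ (y ∷ v) (λ j → inc (fsuc j)) i)

module OrderlyCurrency {k : ℕ} (A : Vec ℕ (suc (suc k))) (cur : Currency A)
                       (orderly : Orderly A) (3≤a₁ : 3 ≤ lookup A (fsuc fzero)) where

  coins : List ℕ
  coins = toList A

  Coin : ℕ → Set
  Coin x = x ∈ coins

  L : ℕ → ℕ
  L = largestCoin coins

  coin-lookup : ∀ i → Coin (lookup A i)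
  coin-lookup i = ∈-toList⁺ (∈-lookup i A)

  coin-index : ∀ {x} → Coin x → Σ[ i ∈ Fin _ ] lookup A i ≡ x
  coin-index x∈ = index (∈-toList⁻ x∈) , sym (lookup-index (∈-toList⁻ x∈))

  open Greedy coins (subst Coin (Currency.first-one cur) (coin-lookup fzero))

  coin-shape : ∀ {x} → Coin x → x ≡ 1 ⊎ 3 ≤ x
  coin-shape x∈ with coin-index x∈
  ... | fzero , a₀≡x = inj₁ (trans (sym a₀≡x) (Currency.first-one cur))
  ... | fsuc i , aᵢ≡x = inj₂ (≤-trans 3≤a₁ (≤-trans (currency-≥a₁ A cur i) (≤-reflexive aᵢ≡x)))

  B : ℕ
  B = sum coins

  coin-≤B : ∀ {x} → Coin x → x ≤ B
  coin-≤B = go coins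
    where
      go : ∀ ys {x} → x ∈ ys → x ≤ sum ys
      go (cons y ys) (here refl) = m≤m+n y (sum ys)
      go (cons y ys) (there x∈) = ≤-trans (go ys x∈) (m≤n+m (sum ys) y)

  coin-remainder : ∀ {x y h} → Coin x → Coin y → L (x + y) ≡ h → h < x + y → Coin (x + y ∸ h)
  coin-remainder {x} {y} {h} x∈ y∈ Lx+y≡h h<x+y with coin-index x∈ | coin-index y∈
  ... | i , refl | j , refl = greedy-≤1⇒∈ _ (m<n⇒0<n∸m h<x+y) (≤-pred greedy≤2)
    where
      greedy≤2 : suc (greedy (x + y ∸ h)) ≤ 2
      greedy≤2 = subst (_≤ 2) (trans (greedy-step _ (≤-<-trans z≤n h<x+y))
                                     (cong (λ l → suc (greedy (x + y ∸ l))) Lx+y≡h))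
                        (orderly-two-coins A orderly i j (≤-<-trans z≤n h<x+y))

  Consecutive : ℕ → Set
  Consecutive x = Coin x × Coin (suc x)

  SmallerPair : ℕ → Set
  SmallerPair m = Σ[ r ∈ ℕ ] r < m × Consecutive r

  window-≤ : ∀ m {g h} → g < h → suc m + g ≤ h + m
  window-≤ m {g} {h} g<h = begin
    suc m + g   ≡⟨ sym (+-suc m g) ⟩
    m + suc g   ≤⟨ +-monoʳ-≤ m g<h ⟩
    m + h       ≡⟨ +-comm m h ⟩
    h + m       ∎
    where open ≤-Reasoning

  smaller-pair : ∀ {m g h} → Consecutive (suc m) → Coin g → Coin h → g < h →
                 h < g + suc m → L (h + m) ≤ h → SmallerPair (suc m)
  smaller-pair {m} {g} {h} (m∈ , m+1∈) g∈ h∈ g<h h<g+m Lh+m≤h =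
    r , r<m+1 , r∈ , r+1∈
    where
      remainder : ∀ {x y} → Coin x → Coin y → h < x + y → x + y ≤ h + m → Coin (x + y ∸ h)
      remainder x∈ y∈ h<x+y x+y≤h+m =
        coin-remainder x∈ y∈ (largestCoin-plateau coins h∈ (<⇒≤ h<x+y) x+y≤h+m Lh+m≤h) h<x+y
      h<c : h < suc m + g
      h<c = <-≤-trans h<g+m (≤-reflexive (+-comm g (suc m)))
      r : ℕ
      r = suc m + g ∸ h
      r∈ : Coin r
      r∈ = remainder m∈ g∈ h<c (window-≤ m g<h)
      r<m+1 : r < suc m
      r<m+1 = subst (r <_) (m+n∸n≡m (suc m) h) (∸-monoˡ-< (+-monoʳ-< (suc m) g<h) (<⇒≤ h<c))
      r+1∈ : Coin (suc r)
      r+1∈ with m≤n⇒m<n∨m≡n g<h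
      ... | inj₂ refl = subst Coin (cong suc (sym (m+n∸n≡m m g))) m∈
      ... | inj₁ g+1<h = subst Coin (+-∸-assoc 1 (<⇒≤ h<c))
              (remainder m+1∈ g∈ (≤-trans h<c (n≤1+n _))
                         (≤-trans (≤-reflexive (sym (+-suc (suc m) g))) (window-≤ m g+1<h)))

  -- Climb through coins g < h < g + m + 1 until the plateau case applies;
  -- d bounds the remaining room B − h.
  climb : ∀ d {m g h} → Consecutive (suc m) → Coin g → Coin h → g < h →
          h < g + suc m → B ≤ h + d → SmallerPair (suc m)
  climb d {m} {g} {h} pair g∈ h∈ g<h h<g+m B≤h+d with h <? L (h + m)
  ... | no h≮h′ = smaller-pair pair g∈ h∈ g<h h<g+m (≮⇒≥ h≮h′)
  ... | yes h<h′ = next d B≤h+d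
    where
      h′∈ : Coin (L (h + m))
      h′∈ = largestCoin-∈ coins (h + m) (≤-<-trans z≤n h<h′)
      h′<h+m+1 : L (h + m) < h + suc m
      h′<h+m+1 = ≤-<-trans (largestCoin-≤ coins (h + m)) (+-monoʳ-< h ≤-refl)
      next : ∀ d → B ≤ h + d → SmallerPair (suc m)
      next zero B≤h = ⊥-elim (<-irrefl refl
        (<-≤-trans h<h′ (≤-trans (coin-≤B h′∈) (≤-trans B≤h (≤-reflexive (+-identityʳ h))))))
      next (suc d) B≤h+d+1 = climb d pair h∈ h′∈ h<h′ h′<h+m+1
        (≤-trans B≤h+d+1 (≤-trans (≤-reflexive (+-suc h d)) (+-monoˡ-≤ d h<h′)))

  no-consecutive : ∀ m → ¬ Consecutive m
  no-consecutive = <-rec (λ m → ¬ Consecutive m) minimal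
    where
      minimal : ∀ m → (∀ {r} → r < m → ¬ Consecutive r) → ¬ Consecutive m
      minimal m smaller (m∈ , m+1∈) with coin-shape m∈ | coin-shape m+1∈
      ... | inj₁ refl | inj₁ ()
      ... | inj₁ refl | inj₂ (s≤s (s≤s ()))
      ... | inj₂ (s≤s {n = m′} 2≤m′) | _ with climb B (m∈ , m+1∈) m∈ m+1∈ ≤-refl m+2<2m (m≤n+m B _)
        where
          m+2<2m : suc (suc m′) < suc m′ + suc m′
          m+2<2m = subst (_≤ suc m′ + suc m′) (+-comm (suc m′) 2) (+-monoʳ-≤ (suc m′) (m≤n⇒m≤1+n 2≤m′))
      ...   | r , r<m , pair = smaller r<m pair

proposition3p1 : (k : ℕ) (A : Vec ℕ (suc (suc k))) → Currency A → Orderly A →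
    3 ≤ lookup A (fsuc fzero) →
    (i : Fin (suc k)) → lookup A (fsuc i) ∸ lookup A (inject₁ i) ≢ 1
proposition3p1 k A cur orderly 3≤a₁ i difference≡1 =
  no-consecutive aᵢ (coin-lookup (inject₁ i) , subst Coin aᵢ₊₁≡aᵢ+1 (coin-lookup (fsuc i)))
  where
    open OrderlyCurrency A cur orderly 3≤a₁
    aᵢ : ℕ
    aᵢ = lookup A (inject₁ i)
    aᵢ₊₁≡aᵢ+1 : lookup A (fsuc i) ≡ suc aᵢ
    aᵢ₊₁≡aᵢ+1 = trans (sym (m+[n∸m]≡n (<⇒≤ (Currency.increasing cur i))))
                      (trans (cong (aᵢ +_) difference≡1) (+-comm aᵢ 1))
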